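{- Let $P_1$ and $P_2$ be paths with vertex colourings $\omega_1$ and $\omega_2$ from colour-set $C$, let $P=P_1P_2$ be the path obtained by concatenating $P_1$ and $P_2$ (joining an end of $P_1$ to an end of $P_2$ by an edge), and let $\omega$ be the colouring of $P$ agreeing with $\omega_i$ on $P_i$. Then for every $d\in C$, $m(P,\omega,d) \leq m(P_1,\omega_1,d)+m(P_2,\omega_2,d)$.
   Context: Free-Flood-It: for a graph $G$ with vertex colouring $\omega$ from colour-set $C$, a move $(v,d)$ gives colour $d$ to every vertex of the monochromatic connected component containing $v$ in the current colouring; moves may be played at any vertex. For a connected graph $G$, $m(G,\omega,d)$ denotes the minimum number of moves needed to give all vertices colour $d$. -}

module Defs where

open import Data.Nat using (ℕ; _+_)
open import Data.Fin using (Fin; toℕ)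
open import Data.Fin.Properties using (all?)
open import Data.Product using (_×_; _,_)
open import Data.Sum using (_⊎_)
open import Data.List using (List; foldl; length)
open import Data.Bool using (if_then_else_)
open import Relation.Binary.PropositionalEquality using (_≡_)
open import Relation.Binary.Definitions using (DecidableEquality)
open import Relation.Nullary using (Dec; does)
open import Relation.Nullary.Decidable using (_×-dec_; _⊎-dec_; _→-dec_)
import Data.Nat as ℕ

-- A path on n vertices 0 - 1 - ... - (n-1); a vertex colouring is a map
-- Fin n → C (the colour set C has decidable equality).
Colouring : ∀ {c} (C : Set c) (n : ℕ) → Set c
Colouring C n = Fin n → C

Between : ∀ {n} → Fin n → Fin n → Fin n → Set
Between i j k = (toℕ i ℕ.≤ toℕ k × toℕ k ℕ.≤ toℕ j) ⊎ (toℕ j ℕ.≤ toℕ k × toℕ k ℕ.≤ toℕ i)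

-- j lies in the monochromatic connected component of i (in a path this is
-- exactly: every vertex between i and j has the colour of i)
SameComp : ∀ {c} {C : Set c} {n} → Colouring C n → Fin n → Fin n → Set c
SameComp ω i j = ∀ k → Between i j k → ω k ≡ ω i

sameComp? : ∀ {c} {C : Set c} → DecidableEquality C → ∀ {n}
          (ω : Colouring C n) (i j : Fin n) → Dec (SameComp ω i j)
sameComp? _≟_ ω i j = all? λ k →
  (((toℕ i ℕ.≤? toℕ k) ×-dec (toℕ k ℕ.≤? toℕ j)) ⊎-dec
   ((toℕ j ℕ.≤? toℕ k) ×-dec (toℕ k ℕ.≤? toℕ i))) →-dec (ω k ≟ ω i)

move : ∀ {c} {C : Set c} → DecidableEquality C → ∀ {n} →
       Colouring C n → Fin n × C → Colouring C n
move _≟_ ω (v , d) j = if does (sameComp? _≟_ ω v j) then d else ω j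

play : ∀ {c} {C : Set c} → DecidableEquality C → ∀ {n} →
       Colouring C n → List (Fin n × C) → Colouring C n
play _≟_ ω ms = foldl (move _≟_) ω ms

-- "m(P_n, ω, d) ≤ k": some sequence of at most k moves floods the path with d
Floods≤ : ∀ {c} {C : Set c} → DecidableEquality C → ∀ {n} →
          Colouring C n → C → ℕ → Set c
Floods≤ {C = C} _≟_ {n} ω d k =
  Data.Product.Σ (List (Fin n × C)) λ ms →
    (length ms ℕ.≤ k) × (∀ v → play _≟_ ω ms v ≡ d)

-- Play a flooding sequence for P₂ at the same vertices of P.  In a path the
-- component of a vertex of P₂ meets P₂ exactly in its component for ω₂ alone, so
-- P₂ evolves as on its own; a component may spill into P₁, but it only ever
-- turns a final stretch of P₁ into one block coloured like the first vertex of
-- P₂.  Afterwards P is ω₁ on an initial segment and d on the rest.  Then play,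
-- mirrored, a flooding sequence for P₁, in which the flooded end of P₁ is a
-- monochromatic block hiding the first simulated vertices: a move there is
-- skipped unless its component leaves the block, and is then replayed at the
-- first vertex after it.  The block colour stays d or that of the first visible
-- vertex, so it is d at the end, and neither phase uses more moves than the
-- sequence it simulates.

module Submission where

open import Data.Bool using (if_then_else_)
open import Data.Empty using (⊥-elim)
open import Data.Fin using (Fin; toℕ; fromℕ<; opposite; _↑ˡ_; _↑ʳ_)
open import Data.Fin.Properties
  using (toℕ<n; toℕ-injective; toℕ-fromℕ<; opposite-prop; opposite-involutive; toℕ-↑ˡ; toℕ-↑ʳ)
open import Data.List using ([]; _∷_; length; map)
import Data.List as List
open import Data.List.Properties using (foldl-++; length-++; length-map)
open import Data.Nat
open import Data.Nat.Properties
open import Data.Product using (∃; _×_; _,_)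
open import Data.Sum using (_⊎_; inj₁; inj₂; [_,_])
import Data.Sum as Sum
open import Data.Vec.Functional using (_++_)
open import Data.Vec.Functional.Properties using (lookup-++ˡ; lookup-++ʳ)
open import Relation.Binary.Definitions using (DecidableEquality)
open import Relation.Binary.PropositionalEquality hiding ([_])
open import Relation.Nullary using (Dec; yes; no; ¬_; does)
open import Relation.Nullary.Decidable using (map′)

open import Defs

Betweenℕ : ℕ → ℕ → ℕ → Set
Betweenℕ i j k = (i ≤ k × k ≤ j) ⊎ (j ≤ k × k ≤ i)

between-sym : ∀ {i j k} → Betweenℕ i j k → Betweenℕ j i k
between-sym = Sum.swap

between-start : ∀ i j → Betweenℕ i j i
between-start i j with i ≤? j
... | yes i≤j = inj₁ (≤-refl , i≤j)
... | no i≰j  = inj₂ (<⇒≤ (≰⇒> i≰j) , ≤-refl)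

between-end : ∀ i j → Betweenℕ i j j
between-end i j = between-sym (between-start j i)

between-inner : ∀ {i j k l} → Betweenℕ i j k → Betweenℕ i k l → Betweenℕ i j l
between-inner (inj₁ (_ , k≤j))   (inj₁ (i≤l , l≤k)) = inj₁ (i≤l , ≤-trans l≤k k≤j)
between-inner (inj₁ (i≤k , k≤j)) (inj₂ (k≤l , l≤i)) =
  inj₁ (≤-trans i≤k k≤l , ≤-trans l≤i (≤-trans i≤k k≤j))
between-inner (inj₂ (j≤k , k≤i)) (inj₁ (i≤l , l≤k)) =
  inj₂ (≤-trans j≤k (≤-trans k≤i i≤l) , ≤-trans l≤k k≤i)
between-inner (inj₂ (j≤k , _))   (inj₂ (k≤l , l≤i)) = inj₂ (≤-trans j≤k k≤l , l≤i)

between-split : ∀ m {i j k} → Betweenℕ i j k → Betweenℕ m i k ⊎ Betweenℕ m j k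
between-split m {k = k} ijk with k ≤? m
between-split m (inj₁ (i≤k , _)) | yes k≤m = inj₁ (inj₂ (i≤k , k≤m))
between-split m (inj₂ (j≤k , _)) | yes k≤m = inj₂ (inj₂ (j≤k , k≤m))
between-split m (inj₁ (_ , k≤j)) | no k≰m  = inj₂ (inj₁ (<⇒≤ (≰⇒> k≰m) , k≤j))
between-split m (inj₂ (_ , k≤i)) | no k≰m  = inj₁ (inj₁ (<⇒≤ (≰⇒> k≰m) , k≤i))

between-lower : ∀ {m i j k} → Betweenℕ i j k → m ≤ i → m ≤ j → m ≤ k
between-lower (inj₁ (i≤k , _)) m≤i _ = ≤-trans m≤i i≤k
between-lower (inj₂ (j≤k , _)) _ m≤j = ≤-trans m≤j j≤k

between-upper : ∀ {m i j k} → Betweenℕ i j k → i ≤ m → j ≤ m → k ≤ m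
between-upper (inj₁ (_ , k≤j)) _ j≤m = ≤-trans k≤j j≤m
between-upper (inj₂ (_ , k≤i)) i≤m _ = ≤-trans k≤i i≤m

between-+ : ∀ o {i j k} → Betweenℕ i j k → Betweenℕ (o + i) (o + j) (o + k)
between-+ o (inj₁ (p , q)) = inj₁ (+-monoʳ-≤ o p , +-monoʳ-≤ o q)
between-+ o (inj₂ (p , q)) = inj₂ (+-monoʳ-≤ o p , +-monoʳ-≤ o q)

between-+⁻¹ : ∀ o {i j k} → Betweenℕ (o + i) (o + j) (o + k) → Betweenℕ i j k
between-+⁻¹ o (inj₁ (p , q)) = inj₁ (+-cancelˡ-≤ o _ _ p , +-cancelˡ-≤ o _ _ q)
between-+⁻¹ o (inj₂ (p , q)) = inj₂ (+-cancelˡ-≤ o _ _ p , +-cancelˡ-≤ o _ _ q)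

module _ {c} {C : Set c} where

  SameCompℕ : (ℕ → C) → ℕ → ℕ → Set c
  SameCompℕ g i j = ∀ k → Betweenℕ i j k → g k ≡ g i

  DecSameComp : ℕ → (ℕ → C) → Set c
  DecSameComp M g = ∀ i j → i < M → j < M → Dec (SameCompℕ g i j)

  sameComp-refl : ∀ g i → SameCompℕ g i i
  sameComp-refl g i k (inj₁ (i≤k , k≤i)) = cong g (≤-antisym k≤i i≤k)
  sameComp-refl g i k (inj₂ (i≤k , k≤i)) = cong g (≤-antisym k≤i i≤k)

  sameComp-end : ∀ {g i j} → SameCompℕ g i j → g j ≡ g i
  sameComp-end {i = i} {j} ij = ij j (between-end i j)

  sameComp-inner : ∀ {g i j k} → SameCompℕ g i j → Betweenℕ i j k → SameCompℕ g i k
  sameComp-inner ij ijk l ikl = ij l (between-inner ijk ikl)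

  sameComp-trans : ∀ {g i j k} → SameCompℕ g i j → SameCompℕ g j k → SameCompℕ g i k
  sameComp-trans {j = j} ij jk l ikl with between-split j ikl
  ... | inj₁ jil = ij l (between-sym jil)
  ... | inj₂ jkl = trans (jk l jkl) (sameComp-end ij)

  sameComp-from : ∀ {g i j k} → SameCompℕ g i j → SameCompℕ g i k → SameCompℕ g j k
  sameComp-from {i = i} ij ik l jkl with between-split i jkl
  ... | inj₁ ijl = trans (ij l ijl) (sym (sameComp-end ij))
  ... | inj₂ ikl = trans (ik l ikl) (sym (sameComp-end ij))

  sameComp-extendDown : ∀ {g u i j} → i ≤ j → j ≤ u → SameCompℕ g u j →
                        (∀ k → i ≤ k → k < j → g k ≡ g u) → SameCompℕ g u i
  sameComp-extendDown i≤j _ uj _ k (inj₁ (u≤k , k≤i)) = uj k (inj₁ (u≤k , ≤-trans k≤i i≤j))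
  sameComp-extendDown {j = j} _ _ uj below k (inj₂ (i≤k , k≤u)) with k <? j
  ... | yes k<j = below k i≤k k<j
  ... | no k≮j  = uj k (inj₂ (≮⇒≥ k≮j , k≤u))

  Shifted : ℕ → ℕ → (ℕ → C) → (ℕ → C) → Set c
  Shifted o a g h = ∀ j → a ≤ j → g (o + j) ≡ h j

  sameComp-unshift : ∀ {o a g h i j} → Shifted o a g h → a ≤ i → a ≤ j →
                     SameCompℕ g (o + i) (o + j) → SameCompℕ h i j
  sameComp-unshift {o} {a} {g} {h} {i} {j} sh a≤i a≤j ij k ijk = begin
    h k       ≡⟨ sym (sh k (between-lower ijk a≤i a≤j)) ⟩
    g (o + k) ≡⟨ ij (o + k) (between-+ o ijk) ⟩
    g (o + i) ≡⟨ sh i a≤i ⟩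
    h i       ∎
    where open ≡-Reasoning

  sameComp-shift : ∀ {o a g h i j} → Shifted o a g h → a ≤ i → a ≤ j →
                   SameCompℕ h i j → SameCompℕ g (o + i) (o + j)
  sameComp-shift {o} {a} {g} {h} {i} {j} sh a≤i a≤j ij k oijk =
    from-offset (between-lower oijk (+-monoʳ-≤ o a≤i) (+-monoʳ-≤ o a≤j))
    where
    open ≡-Reasoning
    from-offset : o + a ≤ k → g k ≡ g (o + i)
    from-offset o+a≤k with m≤n⇒∃[o]m+o≡n (≤-trans (m≤m+n o a) o+a≤k)
    ... | l , refl = begin
      g (o + l) ≡⟨ sh l (+-cancelˡ-≤ o a l o+a≤k) ⟩
      h l       ≡⟨ ij l (between-+⁻¹ o oijk) ⟩
      h i       ≡⟨ sym (sh i a≤i) ⟩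
      g (o + i) ∎

  record MoveSpec (M : ℕ) (g : ℕ → C) (u : ℕ) (e : C) (g′ : ℕ → C) : Set c where
    field
      recoloured : ∀ k → k < M → SameCompℕ g u k → g′ k ≡ e
      kept       : ∀ k → k < M → ¬ SameCompℕ g u k → g′ k ≡ g k
      beyond     : ∀ k → M ≤ k → g′ k ≡ g k

module Run {c} {C : Set c} (_≟_ : DecidableEquality C) (ψ : ℕ → C) (col : C) where

  run : ℕ → ℕ
  run zero = 0
  run (suc p) with ψ p ≟ col
  ... | yes _ = suc (run p)
  ... | no _  = 0

  run≤ : ∀ p → run p ≤ p
  run≤ zero = z≤n
  run≤ (suc p) with ψ p ≟ col
  ... | yes _ = s≤s (run≤ p)
  ... | no _  = z≤n

  run-colour : ∀ p k → p ∸ run p ≤ k → k < p → ψ k ≡ col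
  run-colour (suc p) k p∸run≤k k<p with ψ p ≟ col
  ... | no _ = ⊥-elim (<-irrefl refl (≤-<-trans p∸run≤k k<p))
  ... | yes ψp≡col with m≤n⇒m<n∨m≡n (s≤s⁻¹ k<p)
  ...   | inj₁ k<p′  = run-colour p k p∸run≤k k<p′
  ...   | inj₂ refl = ψp≡col

  run-maximal : ∀ p → run p < p → ψ (p ∸ suc (run p)) ≢ col
  run-maximal (suc p) r<p with ψ p ≟ col
  ... | yes _      = run-maximal p (s≤s⁻¹ r<p)
  ... | no ψp≢col = ψp≢col

module _ {c} {C : Set c} where

  mirror : ∀ {M} → (Fin M → C) → Fin M → C
  mirror ω x = ω (opposite x)

  mirrorMove : ∀ {M} → Fin M × C → Fin M × C
  mirrorMove (v , e) = opposite v , e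

opposite-≤ : ∀ {M} {i k : Fin M} → toℕ k ≤ toℕ i → toℕ (opposite i) ≤ toℕ (opposite k)
opposite-≤ {M} {i} {k} k≤i =
  subst₂ _≤_ (sym (opposite-prop i)) (sym (opposite-prop k)) (∸-monoʳ-≤ M (s≤s k≤i))

between-opposite : ∀ {M} {i j k : Fin M} → Between i j k → Between (opposite i) (opposite j) (opposite k)
between-opposite (inj₁ (i≤k , k≤j)) = inj₂ (opposite-≤ k≤j , opposite-≤ i≤k)
between-opposite (inj₂ (j≤k , k≤i)) = inj₁ (opposite-≤ k≤i , opposite-≤ j≤k)

module _ {c} {C : Set c} (_≟_ : DecidableEquality C) where

  move-cases : ∀ {N} (τ : Fin N → C) v e j →
               (SameComp τ v j × move _≟_ τ (v , e) j ≡ e) ⊎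
               (¬ SameComp τ v j × move _≟_ τ (v , e) j ≡ τ j)
  move-cases τ v e j = by-cases (sameComp? _≟_ τ v j)
    where
    by-cases : ∀ {p} {P : Set p} (P? : Dec P) →
               (P × (if does P? then e else τ j) ≡ e) ⊎ (¬ P × (if does P? then e else τ j) ≡ τ j)
    by-cases (yes p) = inj₁ (p , refl)
    by-cases (no ¬p) = inj₂ (¬p , refl)

  move-cong : ∀ {M} {ω ω′ : Fin M → C} → ω ≗ ω′ → ∀ m → move _≟_ ω m ≗ move _≟_ ω′ m
  move-cong {ω = ω} {ω′} ω≗ω′ (v , e) x with move-cases ω v e x | move-cases ω′ v e x
  ... | inj₁ (_ , ωx≡e) | inj₁ (_ , ω′x≡e)     = trans ωx≡e (sym ω′x≡e)
  ... | inj₂ (_ , ωx≡ωx) | inj₂ (_ , ω′x≡ω′x) = trans ωx≡ωx (trans (ω≗ω′ x) (sym ω′x≡ω′x))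
  ... | inj₁ (vx , _) | inj₂ (¬vx′ , _) =
    ⊥-elim (¬vx′ λ k b → trans (sym (ω≗ω′ k)) (trans (vx k b) (ω≗ω′ v)))
  ... | inj₂ (¬vx , _) | inj₁ (vx′ , _) =
    ⊥-elim (¬vx λ k b → trans (ω≗ω′ k) (trans (vx′ k b) (sym (ω≗ω′ v))))

  play-cong : ∀ {M} {ω ω′ : Fin M → C} ms → ω ≗ ω′ → play _≟_ ω ms ≗ play _≟_ ω′ ms
  play-cong []       ω≗ω′ = ω≗ω′
  play-cong (m ∷ ms) ω≗ω′ = play-cong ms (move-cong ω≗ω′ m)

  sameComp-mirror⁺ : ∀ {M} (ω : Fin M → C) v x → SameComp ω v (opposite x) → SameComp (mirror ω) (opposite v) x
  sameComp-mirror⁺ ω v x vx k b = trans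
    (vx (opposite k) (subst (λ v′ → Between v′ (opposite x) (opposite k)) (opposite-involutive v) (between-opposite b)))
    (cong ω (sym (opposite-involutive v)))

  sameComp-mirror⁻ : ∀ {M} (ω : Fin M → C) v x → SameComp (mirror ω) (opposite v) x → SameComp ω v (opposite x)
  sameComp-mirror⁻ ω v x vx k b = subst₂ (λ k′ v′ → ω k′ ≡ ω v′) (opposite-involutive k) (opposite-involutive v)
    (vx (opposite k) (subst (λ x′ → Between (opposite v) x′ (opposite k))
                            (opposite-involutive x) (between-opposite b)))

  move-mirror : ∀ {M} (ω : Fin M → C) m x → move _≟_ (mirror ω) (mirrorMove m) x ≡ mirror (move _≟_ ω m) x
  move-mirror ω (v , e) x with move-cases (mirror ω) (opposite v) e x | move-cases ω v e (opposite x)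
  ... | inj₁ (_ , p) | inj₁ (_ , q) = trans p (sym q)
  ... | inj₂ (_ , p) | inj₂ (_ , q) = trans p (sym q)
  ... | inj₁ (vx , _) | inj₂ (¬vx , _) = ⊥-elim (¬vx (sameComp-mirror⁻ ω v x vx))
  ... | inj₂ (¬vx , _) | inj₁ (vx , _) = ⊥-elim (¬vx (sameComp-mirror⁺ ω v x vx))

  play-mirror : ∀ {M} ms (ω : Fin M → C) → play _≟_ (mirror ω) (map mirrorMove ms) ≗ mirror (play _≟_ ω ms)
  play-mirror []       ω x = refl
  play-mirror (m ∷ ms) ω x =
    trans (play-cong (map mirrorMove ms) (move-mirror ω m) x) (play-mirror ms (move _≟_ ω m) x)

module _ {c} {C : Set c} (d : C) where

  -- A colouring of the path on N vertices read as a colouring of ℕ; beyond the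
  -- path it is d, so a flooded path extends to a constant colouring.
  extend : ∀ {N} → (Fin N → C) → ℕ → C
  extend {N} τ k with k <? N
  ... | yes k<N = τ (fromℕ< k<N)
  ... | no _    = d

  extend-at : ∀ {N} (τ : Fin N → C) (x : Fin N) {k} → toℕ x ≡ k → extend τ k ≡ τ x
  extend-at {N} τ x {k} x≡k with k <? N
  ... | yes k<N = cong τ (toℕ-injective (trans (toℕ-fromℕ< k<N) (sym x≡k)))
  ... | no k≮N  = ⊥-elim (k≮N (subst (_< N) x≡k (toℕ<n x)))

  extend-≥ : ∀ {N} (τ : Fin N → C) {k} → N ≤ k → extend τ k ≡ d
  extend-≥ {N} τ {k} N≤k with k <? N
  ... | yes k<N = ⊥-elim (<-irrefl refl (<-≤-trans k<N N≤k))
  ... | no _    = refl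

  extend-flooded : ∀ {N} (τ : Fin N → C) → (∀ x → τ x ≡ d) → ∀ k → extend τ k ≡ d
  extend-flooded {N} τ flooded k with k <? N
  ... | yes _ = flooded _
  ... | no _  = refl

  extend-++ˡ : ∀ {n₁ n₂} (ω₁ : Fin n₁ → C) (ω₂ : Fin n₂ → C) {k} → k < n₁ →
               extend (ω₁ ++ ω₂) k ≡ extend ω₁ k
  extend-++ˡ {n₂ = n₂} ω₁ ω₂ k<n₁ = begin
    extend (ω₁ ++ ω₂) _   ≡⟨ extend-at (ω₁ ++ ω₂) (x ↑ˡ n₂)
                               (trans (toℕ-↑ˡ x n₂) (toℕ-fromℕ< k<n₁)) ⟩
    (ω₁ ++ ω₂) (x ↑ˡ n₂)  ≡⟨ lookup-++ˡ ω₁ ω₂ x ⟩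
    ω₁ x                  ≡⟨ sym (extend-at ω₁ x (toℕ-fromℕ< k<n₁)) ⟩
    extend ω₁ _           ∎
    where
    open ≡-Reasoning
    x = fromℕ< k<n₁

  extend-++ʳ : ∀ {n₁ n₂} (ω₁ : Fin n₁ → C) (ω₂ : Fin n₂ → C) j →
               extend (ω₁ ++ ω₂) (n₁ + j) ≡ extend ω₂ j
  extend-++ʳ {n₁} {n₂} ω₁ ω₂ j with <-≤-connex j n₂
  ... | inj₂ n₂≤j = trans (extend-≥ (ω₁ ++ ω₂) (+-monoʳ-≤ n₁ n₂≤j)) (sym (extend-≥ ω₂ n₂≤j))
  ... | inj₁ j<n₂ = begin
    extend (ω₁ ++ ω₂) (n₁ + j) ≡⟨ extend-at (ω₁ ++ ω₂) (n₁ ↑ʳ y)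
                                    (trans (toℕ-↑ʳ n₁ y) (cong (n₁ +_) (toℕ-fromℕ< j<n₂))) ⟩
    (ω₁ ++ ω₂) (n₁ ↑ʳ y)       ≡⟨ lookup-++ʳ ω₁ ω₂ y ⟩
    ω₂ y                       ≡⟨ sym (extend-at ω₂ y (toℕ-fromℕ< j<n₂)) ⟩
    extend ω₂ j                ∎
    where
    open ≡-Reasoning
    y = fromℕ< j<n₂

  FloodedFrom : (ℕ → C) → ℕ → (ℕ → C) → Set c
  FloodedFrom ψ s g = (∀ k → k < s → g k ≡ ψ k) × (∀ k → s ≤ k → g k ≡ d)

  extend-mirror : ∀ {M} (τ : Fin M → C) {k} → k < M → extend (mirror τ) k ≡ extend τ (M ∸ suc k)
  extend-mirror {M} τ k<M = trans (extend-at (mirror τ) x (toℕ-fromℕ< k<M))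
    (sym (extend-at τ (opposite x) (trans (opposite-prop x) (cong (λ k′ → M ∸ suc k′) (toℕ-fromℕ< k<M)))))
    where x = fromℕ< k<M

  floodedFrom-const : ∀ {s g} → FloodedFrom (λ _ → d) s g → ∀ k → g k ≡ d
  floodedFrom-const {s} (below , from) k with <-≤-connex k s
  ... | inj₁ k<s = below k k<s
  ... | inj₂ s≤k = from k s≤k

  sameComp⇒sameCompℕ : ∀ {N} (τ : Fin N → C) i j →
                       SameComp τ i j → SameCompℕ (extend τ) (toℕ i) (toℕ j)
  sameComp⇒sameCompℕ τ i j ij k ijk = begin
    extend τ k  ≡⟨ extend-at τ x (toℕ-fromℕ< k<N) ⟩
    τ x         ≡⟨ ij x (subst (Betweenℕ (toℕ i) (toℕ j)) (sym (toℕ-fromℕ< k<N)) ijk) ⟩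
    τ i         ≡⟨ sym (extend-at τ i refl) ⟩
    extend τ (toℕ i) ∎
    where
    open ≡-Reasoning
    k<N = between-upper (between-+ 1 ijk) (toℕ<n i) (toℕ<n j)
    x = fromℕ< k<N

  sameCompℕ⇒sameComp : ∀ {N} (τ : Fin N → C) i j →
                       SameCompℕ (extend τ) (toℕ i) (toℕ j) → SameComp τ i j
  sameCompℕ⇒sameComp τ i j ij x ijx =
    trans (sym (extend-at τ x refl)) (trans (ij (toℕ x) ijx) (extend-at τ i refl))

  module _ (_≟_ : DecidableEquality C) where

    sameCompℕ? : ∀ {N} (τ : Fin N → C) → DecSameComp N (extend τ)
    sameCompℕ? τ i j i<N j<N =
      map′ (λ ij → subst₂ (SameCompℕ (extend τ)) i≡ j≡ (sameComp⇒sameCompℕ τ _ _ ij))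
           (λ ij → sameCompℕ⇒sameComp τ _ _ (subst₂ (SameCompℕ (extend τ)) (sym i≡) (sym j≡) ij))
           (sameComp? _≟_ τ (fromℕ< i<N) (fromℕ< j<N))
      where
      i≡ = toℕ-fromℕ< i<N
      j≡ = toℕ-fromℕ< j<N

    move-spec : ∀ {N} (τ : Fin N → C) v e {u} → toℕ v ≡ u →
                MoveSpec N (extend τ) u e (extend (move _≟_ τ (v , e)))
    move-spec {N} τ v e refl = record { recoloured = recoloured ; kept = kept ; beyond = beyond }
      where
      τ′ = move _≟_ τ (v , e)
      recoloured : ∀ k → k < N → SameCompℕ (extend τ) (toℕ v) k → extend τ′ k ≡ e
      recoloured k k<N vk with move-cases _≟_ τ v e (fromℕ< k<N)
      ... | inj₁ (_ , τ′k≡e) = trans (extend-at τ′ _ (toℕ-fromℕ< k<N)) τ′k≡e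
      ... | inj₂ (¬vk , _)   =
        ⊥-elim (¬vk (sameCompℕ⇒sameComp τ _ _
                      (subst (SameCompℕ (extend τ) (toℕ v)) (sym (toℕ-fromℕ< k<N)) vk)))
      kept : ∀ k → k < N → ¬ SameCompℕ (extend τ) (toℕ v) k → extend τ′ k ≡ extend τ k
      kept k k<N ¬vk with move-cases _≟_ τ v e (fromℕ< k<N)
      ... | inj₂ (_ , τ′k≡τk) =
        trans (extend-at τ′ _ (toℕ-fromℕ< k<N)) (trans τ′k≡τk (sym (extend-at τ _ (toℕ-fromℕ< k<N))))
      ... | inj₁ (vk , _)     =
        ⊥-elim (¬vk (subst (SameCompℕ (extend τ) (toℕ v)) (toℕ-fromℕ< k<N) (sameComp⇒sameCompℕ τ _ _ vk)))
      beyond : ∀ k → N ≤ k → extend τ′ k ≡ extend τ k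
      beyond k N≤k = trans (extend-≥ τ′ N≤k) (sym (extend-≥ τ N≤k))

predecessor : ∀ {m} → 0 < m → ∃ λ q → q < m × m ≤ suc q
predecessor {suc q} _ = q , ≤-refl , ≤-refl

module Simulation {c} {C : Set c} (_≟_ : DecidableEquality C) (d : C) (ψ : ℕ → C)
                  (o n N : ℕ) (o+n≡N : o + n ≡ N) (a : ℕ) (a≤n : a ≤ n) where

  -- g is the real colouring of the long path and h the simulated colouring of
  -- the short one, placed at offset o; the block [start, o + a) hides the first
  -- a simulated vertices, and colour-ok makes the block d once h is flooded.
  record Invariant (g h : ℕ → C) : Set c where
    field
      start     : ℕ
      colour    : C
      start≤o   : start ≤ o
      before    : ∀ k → k < start → g k ≡ ψ k
      block     : ∀ k → start ≤ k → k < o + a → g k ≡ colour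
      window    : Shifted o a g h
      colour-ok : colour ≡ d ⊎ (a < n × colour ≡ h a) ⊎ o + a ≤ start

  data StepResult (g h′ : ℕ → C) (e : C) : Set c where
    skip   : Invariant g h′ → StepResult g h′ e
    playAt : ∀ w → w < n → (∀ {g′} → MoveSpec N g (o + w) e g′ → Invariant g′ h′) →
             StepResult g h′ e

  Outcome : (ℕ → C) → Set c
  Outcome g = ∃ λ s → s ≤ o × FloodedFrom d ψ s g

  o+a≤N : o + a ≤ N
  o+a≤N = subst (o + a ≤_) o+n≡N (+-monoʳ-≤ o a≤n)

  o+w<N : ∀ {w} → w < n → o + w < N
  o+w<N w<n = subst (o + _ <_) o+n≡N (+-monoʳ-< o w<n)

  module Step {g h h′ : ℕ → C} {v : ℕ} {e : C} (I : Invariant g h) (v<n : v < n)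
              (hs : MoveSpec n h v e h′) where
    open Invariant I
    module H = MoveSpec hs

    skip-move : v < a → (n ≤ a ⊎ ¬ SameCompℕ h v a) → Invariant g h′
    skip-move v<a untouched = record
      { start = start ; colour = colour ; start≤o = start≤o ; before = before ; block = block
      ; window = λ j a≤j → trans (window j a≤j) (sym (h′≡h j a≤j))
      ; colour-ok =
          Sum.map₂ (Sum.map₁ λ (a<n , col≡ha) → a<n , trans col≡ha (sym (h′≡h a ≤-refl))) colour-ok
      }
      where
      h′≡h : ∀ j → a ≤ j → h′ j ≡ h j
      h′≡h j a≤j with <-≤-connex j n
      ... | inj₂ n≤j = H.beyond j n≤j
      ... | inj₁ j<n = H.kept j j<n λ vj →
        [ (λ n≤a → <-irrefl refl (<-≤-trans j<n (≤-trans n≤a a≤j)))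
        , (λ ¬va → ¬va (sameComp-inner vj (inj₁ (<⇒≤ v<a , a≤j)))) ] untouched

    module AfterMove {w} (a≤w : a ≤ w) (w<n : w < n) (vw : SameCompℕ h v w)
                     (g? : DecSameComp N g) {g′ : ℕ → C} (gs : MoveSpec N g (o + w) e g′) where
      module G = MoveSpec gs

      u = o + w

      o+a≤u : o + a ≤ u
      o+a≤u = +-monoʳ-≤ o a≤w

      window′ : Shifted o a g′ h′
      window′ j a≤j with <-≤-connex j n
      ... | inj₂ n≤j = begin
        g′ (o + j) ≡⟨ G.beyond (o + j) (subst (_≤ o + j) o+n≡N (+-monoʳ-≤ o n≤j)) ⟩
        g (o + j)  ≡⟨ window j a≤j ⟩
        h j        ≡⟨ sym (H.beyond j n≤j) ⟩
        h′ j       ∎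
        where open ≡-Reasoning
      ... | inj₁ j<n with g? u (o + j) (o+w<N w<n) (o+w<N j<n)
      ...   | yes uj = trans (G.recoloured _ (o+w<N j<n) uj)
                             (sym (H.recoloured j j<n (sameComp-trans vw (sameComp-unshift window a≤w a≤j uj))))
      ...   | no ¬uj = trans (G.kept _ (o+w<N j<n) ¬uj) (trans (window j a≤j) (sym (H.kept j j<n λ vj →
                             ¬uj (sameComp-shift window a≤w a≤j (sameComp-from vw vj)))))

      no-merge : (∀ k → k < o + a → ¬ SameCompℕ g u k) → Invariant g′ h′
      no-merge untouched = record
        { start = start ; colour = colour ; start≤o = start≤o
        ; before = λ k k<start → trans (unchanged k (<-≤-trans k<start (≤-trans start≤o (m≤m+n o a))))
                                       (before k k<start)
        ; block = λ k start≤k k<o+a → trans (unchanged k k<o+a) (block k start≤k k<o+a)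
        ; window = window′
        ; colour-ok = colour-ok′
        }
        where
        unchanged : ∀ k → k < o + a → g′ k ≡ g k
        unchanged k k<o+a = G.kept k (<-≤-trans k<o+a o+a≤N) (untouched k k<o+a)

        colour-ok′ : colour ≡ d ⊎ (a < n × colour ≡ h′ a) ⊎ o + a ≤ start
        colour-ok′ with colour-ok
        ... | inj₁ col≡d = inj₁ col≡d
        ... | inj₂ (inj₂ empty) = inj₂ (inj₂ empty)
        ... | inj₂ (inj₁ (a<n , col≡ha)) with o + a ≤? start
        ...   | yes empty = inj₂ (inj₂ empty)
        ...   | no nonempty = inj₂ (inj₁ (a<n , trans col≡ha (sym (H.kept a a<n ¬va))))
          where
          start<o+a = ≰⇒> nonempty
          ¬va : ¬ SameCompℕ h v a
          ¬va va = untouched start start<o+a (sameComp-extendDown (<⇒≤ start<o+a) o+a≤u u-o+a block-colour)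
            where
            u-o+a : SameCompℕ g u (o + a)
            u-o+a = sameComp-shift window a≤w ≤-refl (sameComp-from vw va)
            block-colour : ∀ k → start ≤ k → k < o + a → g k ≡ g u
            block-colour k start≤k k<o+a = begin
              g k       ≡⟨ block k start≤k k<o+a ⟩
              colour    ≡⟨ col≡ha ⟩
              h a       ≡⟨ sym (window a ≤-refl) ⟩
              g (o + a) ≡⟨ sameComp-end u-o+a ⟩
              g u       ∎
              where open ≡-Reasoning

      merge : ∀ q → q < o + a → o + a ≤ suc q → SameCompℕ g u q → Invariant g′ h′
      merge q q<o+a o+a≤1+q uq = record
        { start = start ∸ r ; colour = e ; start≤o = ≤-trans (m∸n≤m start r) start≤o
        ; before = before′ ; block = block′ ; window = window′
        ; colour-ok = inj₂ (inj₁ (a<n , sym (H.recoloured a a<n va)))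
        }
        where
        -- The move swallows the block together with the stretch of ψ of colour
        -- g u just below it, so the new block starts r positions further left.
        open Run _≟_ ψ (g u)
        r = run start
        a<n = ≤-<-trans a≤w w<n
        start≤u = ≤-trans start≤o (≤-trans (m≤m+n o a) o+a≤u)

        u-o+a : SameCompℕ g u (o + a)
        u-o+a = sameComp-inner uq (inj₂ (<⇒≤ q<o+a , o+a≤u))

        va : SameCompℕ h v a
        va = sameComp-trans vw (sameComp-unshift window a≤w ≤-refl u-o+a)

        before′ : ∀ k → k < start ∸ r → g′ k ≡ ψ k
        before′ k k<start∸r = trans (G.kept k (<-≤-trans k<start (≤-trans start≤u (<⇒≤ (o+w<N w<n)))) ¬uk)
                                    (before k k<start)
          where
          k<start = <-≤-trans k<start∸r (m∸n≤m start r)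
          r<start : r < start
          r<start = m∸n≢0⇒n<m λ start∸r≡0 → n≮0 (subst (k <_) start∸r≡0 k<start∸r)
          m = start ∸ suc r
          m<start : m < start
          m<start = ∸-monoʳ-< z<s r<start
          ¬uk : ¬ SameCompℕ g u k
          ¬uk uk = run-maximal start r<start (trans (sym (before m m<start))
            (uk m (inj₂ (subst (k ≤_) (pred[m∸n]≡m∸[1+n] start r) (<⇒≤pred k<start∸r) ,
                         ≤-trans (<⇒≤ m<start) start≤u))))

        block′ : ∀ k → start ∸ r ≤ k → k < o + a → g′ k ≡ e
        block′ k start∸r≤k k<o+a =
          G.recoloured k (<-≤-trans k<o+a o+a≤N) (sameComp-extendDown (<⇒≤ k<o+a) o+a≤u u-o+a coloured)
          where
          coloured : ∀ l → k ≤ l → l < o + a → g l ≡ g u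
          coloured l k≤l l<o+a with l <? start
          ... | yes l<start = trans (before l l<start) (run-colour start l (≤-trans start∸r≤k k≤l) l<start)
          ... | no l≮start = begin
            g l    ≡⟨ block l (≮⇒≥ l≮start) l<o+a ⟩
            colour ≡⟨ sym (block q (≤-trans (≮⇒≥ l≮start) (s≤s⁻¹ (≤-trans l<o+a o+a≤1+q))) q<o+a) ⟩
            g q    ≡⟨ sameComp-end uq ⟩
            g u    ∎
            where open ≡-Reasoning

      after-move : Invariant g′ h′
      after-move with <-≤-connex 0 (o + a)
      ... | inj₂ o+a≤0 = no-merge λ k k<o+a → ⊥-elim (n≮0 (<-≤-trans k<o+a o+a≤0))
      ... | inj₁ 0<o+a with predecessor 0<o+a
      ...   | q , q<o+a , o+a≤1+q with g? u q (o+w<N w<n) (<-≤-trans q<o+a o+a≤N)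
      ...     | yes uq = merge q q<o+a o+a≤1+q uq
      ...     | no ¬uq = no-merge λ k k<o+a uk →
                  ¬uq (sameComp-inner uk (inj₂ (s≤s⁻¹ (≤-trans k<o+a o+a≤1+q) ,
                                               ≤-trans (<⇒≤ q<o+a) o+a≤u)))

    -- A simulated move at a hidden vertex v < a is invisible in g unless its
    -- component reaches a; it is then replayed at the first visible vertex a.
    step : DecSameComp N g → DecSameComp n h → StepResult g h′ e
    step g? h? with a ≤? v
    ... | yes a≤v = playAt v v<n (AfterMove.after-move a≤v v<n (sameComp-refl h v) g?)
    ... | no a≰v with a <? n
    ...   | no a≮n = skip (skip-move (≰⇒> a≰v) (inj₁ (≮⇒≥ a≮n)))
    ...   | yes a<n with h? v a v<n a<n
    ...     | yes va = playAt a a<n (AfterMove.after-move ≤-refl a<n va g?)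
    ...     | no ¬va = skip (skip-move (≰⇒> a≰v) (inj₂ ¬va))

  finish : ∀ {g h} → Invariant g h → (∀ j → h j ≡ d) → Outcome g
  finish {g} {h} I flooded = start , start≤o , before , from-start
    where
    open Invariant I
    from-start : ∀ k → start ≤ k → g k ≡ d
    from-start k start≤k with k <? o + a
    ... | yes k<o+a = trans (block k start≤k k<o+a) colour≡d
      where
      colour≡d : colour ≡ d
      colour≡d with colour-ok
      ... | inj₁ col≡d = col≡d
      ... | inj₂ (inj₁ (_ , col≡ha)) = trans col≡ha (flooded a)
      ... | inj₂ (inj₂ o+a≤start) = ⊥-elim (<-irrefl refl (<-≤-trans k<o+a (≤-trans o+a≤start start≤k)))
    ... | no k≮o+a with m≤n⇒∃[o]m+o≡n (≤-trans (m≤m+n o a) (≮⇒≥ k≮o+a))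
    ...   | j , refl = trans (window j (+-cancelˡ-≤ o a j (≮⇒≥ k≮o+a))) (flooded j)

  simulate : ∀ ms (ρ : Fin n → C) (τ : Fin N → C) → Invariant (extend d τ) (extend d ρ) →
             (∀ y → play _≟_ ρ ms y ≡ d) →
             ∃ λ ms′ → length ms′ ≤ length ms × Outcome (extend d (play _≟_ τ ms′))
  simulate [] ρ τ I flooded = [] , z≤n , finish I (extend-flooded d ρ flooded)
  simulate ((v , e) ∷ ms) ρ τ I flooded
    with Step.step I (toℕ<n v) (move-spec d _≟_ ρ v e refl) (sameCompℕ? d _≟_ τ) (sameCompℕ? d _≟_ ρ)
  ... | skip I′ =
    let ms′ , |ms′|≤|ms| , outcome = simulate ms (move _≟_ ρ (v , e)) τ I′ flooded
    in ms′ , m≤n⇒m≤1+n |ms′|≤|ms| , outcome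
  ... | playAt w w<n continue =
    let u = fromℕ< (o+w<N w<n)
        I′ = continue (move-spec d _≟_ τ u e (toℕ-fromℕ< (o+w<N w<n)))
        ms′ , |ms′|≤|ms| , outcome = simulate ms (move _≟_ ρ (v , e)) (move _≟_ τ (u , e)) I′ flooded
    in (u , e) ∷ ms′ , s≤s |ms′|≤|ms| , outcome

module _ {c} {C : Set c} (_≟_ : DecidableEquality C) (d : C) where

  floods≤-mono : ∀ {N} {ω : Fin N → C} {k k′} → k ≤ k′ →
                 Floods≤ _≟_ ω d k → Floods≤ _≟_ ω d k′
  floods≤-mono k≤k′ (ms , |ms|≤k , flooded) = ms , ≤-trans |ms|≤k k≤k′ , flooded

  floods≤-after : ∀ {N} (ω : Fin N → C) ms {k} →
                  Floods≤ _≟_ (play _≟_ ω ms) d k → Floods≤ _≟_ ω d (length ms + k)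
  floods≤-after ω ms (ms′ , |ms′|≤k , flooded) =
    ms List.++ ms′ ,
    subst (_≤ length ms + _) (sym (length-++ ms)) (+-monoʳ-≤ (length ms) |ms′|≤k) ,
    λ x → trans (cong (λ ω′ → ω′ x) (foldl-++ (move _≟_) ω ms ms′)) (flooded x)

  flood-right : ∀ {n₁ n₂ k} (ω₁ : Fin n₁ → C) (ω₂ : Fin n₂ → C) → Floods≤ _≟_ ω₂ d k →
                ∃ λ ms → length ms ≤ k ×
                  ∃ λ s → s ≤ n₁ × FloodedFrom d (extend d ω₁) s (extend d (play _≟_ (ω₁ ++ ω₂) ms))
  flood-right {n₁} {n₂} ω₁ ω₂ (ms , |ms|≤k , flooded) =
    let ms′ , |ms′|≤|ms| , outcome = simulate ms ω₂ (ω₁ ++ ω₂) initial flooded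
    in ms′ , ≤-trans |ms′|≤|ms| |ms|≤k , outcome
    where
    open Simulation _≟_ d (extend d ω₁) n₁ n₂ (n₁ + n₂) refl 0 z≤n
    initial : Invariant (extend d (ω₁ ++ ω₂)) (extend d ω₂)
    initial = record
      { start = n₁ ; colour = d ; start≤o = ≤-refl
      ; before = λ k k<n₁ → extend-++ˡ d ω₁ ω₂ k<n₁
      ; block = λ k n₁≤k k<n₁+0 →
          ⊥-elim (<-irrefl refl (<-≤-trans k<n₁+0 (≤-trans (≤-reflexive (+-identityʳ n₁)) n₁≤k)))
      ; window = λ j _ → extend-++ʳ d ω₁ ω₂ j
      ; colour-ok = inj₁ refl
      }

  flood-left : ∀ {n₁ n₂ k s} (ω₁ : Fin n₁ → C) (τ : Fin (n₁ + n₂) → C) → s ≤ n₁ →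
               FloodedFrom d (extend d ω₁) s (extend d τ) → Floods≤ _≟_ ω₁ d k → Floods≤ _≟_ τ d k
  flood-left {n₁} {n₂} {k} {s} ω₁ τ s≤n₁ (agrees , flooded-from) (ms , |ms|≤k , flooded) =
    let ms′ , |ms′|≤|ms| , _ , _ , outcome =
          simulate (map mirrorMove ms) (mirror ω₁) (mirror τ) initial mirror-flooded
    in map mirrorMove ms′ , length-bound ms′ |ms′|≤|ms| , unmirror ms′ (floodedFrom-const d outcome)
    where
    -- In the mirror image P₁ is the right-hand piece, and its already flooded
    -- part [s, n₁) becomes the hidden prefix of length n₁ ∸ s.
    open Simulation _≟_ d (λ _ → d) n₂ n₁ (n₁ + n₂) (+-comm n₂ n₁) (n₁ ∸ s) (m∸n≤m n₁ s)
    N = n₁ + n₂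

    block-index : ∀ {k} → k < n₂ + (n₁ ∸ s) → s ≤ N ∸ suc k
    block-index {k} k<n₂+[n₁∸s] = m+n≤o⇒m≤o∸n s (begin
      s + suc k               ≤⟨ +-monoʳ-≤ s k<n₂+[n₁∸s] ⟩
      s + (n₂ + (n₁ ∸ s))     ≡⟨ sym (+-assoc s n₂ _) ⟩
      (s + n₂) + (n₁ ∸ s)     ≡⟨ cong (_+ (n₁ ∸ s)) (+-comm s n₂) ⟩
      (n₂ + s) + (n₁ ∸ s)     ≡⟨ +-assoc n₂ s _ ⟩
      n₂ + (s + (n₁ ∸ s))     ≡⟨ cong (n₂ +_) (m+[n∸m]≡n s≤n₁) ⟩
      n₂ + n₁                 ≡⟨ +-comm n₂ n₁ ⟩
      N                       ∎)
      where open ≤-Reasoning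

    window-index : ∀ j → N ∸ suc (n₂ + j) ≡ n₁ ∸ suc j
    window-index j = trans (cong₂ _∸_ (+-comm n₁ n₂) (sym (+-suc n₂ j))) ([m+n]∸[m+o]≡n∸o n₂ n₁ (suc j))

    window-index< : ∀ {j} → j < n₁ → n₁ ∸ s ≤ j → n₁ ∸ suc j < s
    window-index< {j} j<n₁ n₁∸s≤j = <-≤-trans (∸-monoʳ-< (n<1+n j) j<n₁)
      (≤-trans (∸-monoʳ-≤ n₁ n₁∸s≤j) (≤-reflexive (m∸[m∸n]≡n s≤n₁)))

    initial : Invariant (extend d (mirror τ)) (extend d (mirror ω₁))
    initial = record
      { start = 0 ; colour = d ; start≤o = z≤n ; before = λ _ ()
      ; block = block ; window = window ; colour-ok = inj₁ refl
      }
      where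
      block : ∀ k → 0 ≤ k → k < n₂ + (n₁ ∸ s) → extend d (mirror τ) k ≡ d
      block k _ k<n₂+[n₁∸s] with <-≤-connex k N
      ... | inj₁ k<N = trans (extend-mirror d τ k<N) (flooded-from _ (block-index k<n₂+[n₁∸s]))
      ... | inj₂ N≤k = extend-≥ d (mirror τ) N≤k
      window : Shifted n₂ (n₁ ∸ s) (extend d (mirror τ)) (extend d (mirror ω₁))
      window j n₁∸s≤j with <-≤-connex j n₁
      ... | inj₁ j<n₁ = begin
        extend d (mirror τ) (n₂ + j)  ≡⟨ extend-mirror d τ (o+w<N j<n₁) ⟩
        extend d τ (N ∸ suc (n₂ + j)) ≡⟨ cong (extend d τ) (window-index j) ⟩
        extend d τ (n₁ ∸ suc j)       ≡⟨ agrees _ (window-index< j<n₁ n₁∸s≤j) ⟩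
        extend d ω₁ (n₁ ∸ suc j)      ≡⟨ sym (extend-mirror d ω₁ j<n₁) ⟩
        extend d (mirror ω₁) j        ∎
        where open ≡-Reasoning
      ... | inj₂ n₁≤j =
        trans (extend-≥ d (mirror τ) (subst (_≤ n₂ + j) (+-comm n₂ n₁) (+-monoʳ-≤ n₂ n₁≤j)))
              (sym (extend-≥ d (mirror ω₁) n₁≤j))

    mirror-flooded : ∀ y → play _≟_ (mirror ω₁) (map mirrorMove ms) y ≡ d
    mirror-flooded y = trans (play-mirror _≟_ ms ω₁ y) (flooded (opposite y))

    length-bound : ∀ ms′ → length ms′ ≤ length (map mirrorMove ms) → length (map mirrorMove ms′) ≤ k
    length-bound ms′ |ms′|≤ =
      ≤-trans (subst₂ _≤_ (sym (length-map mirrorMove ms′)) (length-map mirrorMove ms) |ms′|≤) |ms|≤k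

    unmirror : ∀ ms′ → (∀ k → extend d (play _≟_ (mirror τ) ms′) k ≡ d) →
               ∀ x → play _≟_ τ (map mirrorMove ms′) x ≡ d
    unmirror ms′ flooded′ x = begin
      play _≟_ τ (map mirrorMove ms′) x
        ≡⟨ play-cong _≟_ (map mirrorMove ms′) (λ y → cong τ (sym (opposite-involutive y))) x ⟩
      play _≟_ (mirror (mirror τ)) (map mirrorMove ms′) x
        ≡⟨ play-mirror _≟_ ms′ (mirror τ) x ⟩
      play _≟_ (mirror τ) ms′ (opposite x)
        ≡⟨ sym (extend-at d _ (opposite x) refl) ⟩
      extend d (play _≟_ (mirror τ) ms′) (toℕ (opposite x))
        ≡⟨ flooded′ _ ⟩
      d ∎
      where open ≡-Reasoning

lemma4p2 : ∀ {c} {C : Set c} (_≟_ : DecidableEquality C) {n₁ n₂ : ℕ}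
           (ω₁ : Colouring C n₁) (ω₂ : Colouring C n₂) (d : C) (k₁ k₂ : ℕ) →
           Floods≤ _≟_ ω₁ d k₁ → Floods≤ _≟_ ω₂ d k₂ →
           Floods≤ _≟_ (ω₁ ++ ω₂) d (k₁ + k₂)
lemma4p2 _≟_ ω₁ ω₂ d k₁ k₂ floods₁ floods₂ =
  let ms , |ms|≤k₂ , s , s≤n₁ , flooded-from = flood-right _≟_ d ω₁ ω₂ floods₂
  in floods≤-mono _≟_ d (≤-trans (+-monoˡ-≤ k₁ |ms|≤k₂) (≤-reflexive (+-comm k₂ k₁)))
       (floods≤-after _≟_ d (ω₁ ++ ω₂) ms (flood-left _≟_ d ω₁ _ s≤n₁ flooded-from floods₁))
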